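{- For every odd $k\ge25$ there exists a degree-$4$ multilinear polynomial $\mathcal{Q}:\{ -1,1\}^k\to\mathbb{R}$ that $0.1$-separates $\mathrm{Thr}_k^1$ (the majority predicate on $k$ bits).
   Context: For odd $k$, $\mathrm{Thr}_k^1:\{ -1,1\}^k\to\{0,1\}$ is $1$ on $z$ iff $\sum_{i=1}^kz_i\ge1$. For $P:\{ -1,1\}^k\to\{0,1\}$ and $0<\delta<1$, a multilinear polynomial $Q(z)=\sum_S\widehat Q(S)\prod_{i\in S}z_i$ $\delta$-separates $P$ if $Q(z)\ge\delta-1$ for all $z\in\{ -1,1\}^k$, $Q(z)\ge\delta$ for all $z\in P^{ -1}(1)$, and $\widehat Q(\emptyset)=0$. -}

module Defs where

open import Data.Nat using (ℕ; zero; suc; _*_)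
import Data.Nat as ℕ
open import Data.Integer as ℤ using (ℤ)
open import Data.Rational using (ℚ; 0ℚ; 1ℚ; _+_; _-_; _≤_) renaming (_*_ to _*ℚ_; -_ to -ℚ_)
import Data.Rational as ℚ
open import Data.Sign using (Sign)
open import Data.Vec using (Vec; []; _∷_)
open import Data.Fin.Subset using (Subset; Side; inside; outside; ∣_∣; ⊥)
open import Data.Product using (∃)
open import Relation.Binary.PropositionalEquality using (_≡_)

Odd : ℕ → Set
Odd k = ∃ λ m → k ≡ suc (2 * m)

-- a point of {-1,1}^k : Sign.+ ↦ 1, Sign.- ↦ -1
Cube : ℕ → Set
Cube k = Vec Sign k

sgnℤ : Sign → ℤ
sgnℤ Sign.+ = ℤ.+ 1
sgnℤ Sign.- = ℤ.-[1+ 0 ]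

sgnℚ : Sign → ℚ
sgnℚ Sign.+ = 1ℚ
sgnℚ Sign.- = -ℚ 1ℚ

coordSum : ∀ {k} → Cube k → ℤ
coordSum [] = ℤ.+ 0
coordSum (s ∷ z) = sgnℤ s ℤ.+ coordSum z

-- Thr_k^1(z) = 1 iff Σ z_i ≥ 1 ; stated as the proposition "Thr_k^1(z) = 1"
Thr1 : ∀ {k} → Cube k → Set
Thr1 z = ℤ.+ 1 ℤ.≤ coordSum z

monomial : ∀ {k} → Subset k → Cube k → ℚ
monomial [] [] = 1ℚ
monomial (inside ∷ S) (s ∷ z) = sgnℚ s *ℚ monomial S z
monomial (outside ∷ S) (s ∷ z) = monomial S z

sumSubsets : ∀ {k} → (Subset k → ℚ) → ℚ
sumSubsets {zero} f = f []
sumSubsets {suc k} f = sumSubsets (λ S → f (outside ∷ S)) + sumSubsets (λ S → f (inside ∷ S))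

-- multilinear polynomial given by its Fourier coefficients  Q̂ : Subset k → ℚ
MultilinPoly : ℕ → Set
MultilinPoly k = Subset k → ℚ

eval : ∀ {k} → MultilinPoly k → Cube k → ℚ
eval Q z = sumSubsets (λ S → Q S *ℚ monomial S z)

DegreeAtMost : ∀ {k} → ℕ → MultilinPoly k → Set
DegreeAtMost d Q = ∀ S → d ℕ.< ∣ S ∣ → Q S ≡ 0ℚ

record Separates {k} (δ : ℚ) (P : Cube k → Set) (Q : MultilinPoly k) : Set where
  field
    lowerAll  : ∀ z → δ - 1ℚ ≤ eval Q z
    lowerSat  : ∀ z → P z → δ ≤ eval Q z
    noConst   : Q ⊥ ≡ 0ℚ

-- Take Q(z) = g(t s) - c with s = Σ zᵢ, t = 1/⌊√k⌋, g(v) = 1 + v (v-2)² (2v+5) / 40, and c the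
-- constant Fourier coefficient of g(t s), so that Q̂(∅) = 0. Multilinearising turns s², s³, s⁴ into
-- polynomials in k and the elementary symmetric polynomials of z, so Q has degree 4 and its Fourier
-- coefficients depend only on |S|. Since g ≥ 0 everywhere (a sum of squares) and g ≥ 1 on v ≥ 0, where
-- Thr holds, it suffices that c ≤ 9/10. Now c ≤ 1 - 3a/10 + 3a²/20 with a = t²k ∈ [1, 1 + 2t], and this
-- is at most 9/10 as soon as a ≤ 3/2, i.e. ⌊√k⌋ ≥ 4.

module Submission where

open import Defs
open import Data.Nat using (ℕ; _≤_)
open import Data.Integer using (+_)
open import Data.Rational using (_/_)
open import Data.Product using (∃; _×_)

open import Algebra.Bundles using (CommutativeRing)
open import Data.Fin.Subset using (Subset; inside; outside; ∣_∣)
open import Data.Fin.Subset.Properties using (∣⊥∣≡0)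
import Data.Integer as ℤ
import Data.Integer.Properties as ℤ
open import Data.Nat as ℕ using (zero; suc; _<_; z≤n; s≤s)
import Data.Nat.Properties as ℕ
open import Data.Product using (_,_)
open import Data.Rational as ℚ using (ℚ; 0ℚ; 1ℚ; _+_; _*_; -_; _-_; 1/_; *≤*)
open import Data.Rational.Literals using (fromℤ)
import Data.Rational.Properties as ℚ
open import Data.Rational.Solver using (module +-*-Solver)
open import Data.Sign using (Sign)
open import Data.Sum using (inj₁; inj₂)
open import Data.Vec using (_∷_; [])
open import Function using (_∘_)
open import Relation.Binary.PropositionalEquality
open import Relation.Nullary using (yes; no; contradiction)

open import Algebra.Properties.CommutativeSemigroup
  (CommutativeRing.*-commutativeSemigroup ℚ.+-*-commutativeRing) using (x∙yz≈y∙xz)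
open +-*-Solver using (Polynomial; _:+_; _:*_; :-_; con; solve; _:=_)

fromℤ-+ : ∀ a b → fromℤ (a ℤ.+ b) ≡ fromℤ a + fromℤ b
fromℤ-+ a b = begin
  fromℤ (a ℤ.+ b)
    ≡⟨ ℚ.↥p/↧p≡p (fromℤ (a ℤ.+ b)) ⟨
  (a ℤ.+ b) / 1
    ≡⟨ cong₂ (λ x y → (x ℤ.+ y) / 1) (ℤ.*-identityʳ a) (ℤ.*-identityʳ b) ⟨
  (a ℤ.* ℤ.+ 1 ℤ.+ b ℤ.* ℤ.+ 1) / 1
    ≡⟨⟩
  fromℤ a + fromℤ b ∎
  where open ≡-Reasoning

fromℤ-* : ∀ a b → fromℤ (a ℤ.* b) ≡ fromℤ a * fromℤ b
fromℤ-* a b = sym (ℚ.↥p/↧p≡p (fromℤ (a ℤ.* b)))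

fromℤ-mono-≤ : ∀ {a b} → a ℤ.≤ b → fromℤ a ℚ.≤ fromℤ b
fromℤ-mono-≤ {a} {b} a≤b = *≤* (subst₂ ℤ._≤_ (sym (ℤ.*-identityʳ a)) (sym (ℤ.*-identityʳ b)) a≤b)

fromℕ : ℕ → ℚ
fromℕ n = fromℤ (+ n)

fromℕ-suc : ∀ n → fromℕ (suc n) ≡ 1ℚ + fromℕ n
fromℕ-suc n = fromℤ-+ (+ 1) (+ n)

fromℕ-* : ∀ m n → fromℕ (m ℕ.* n) ≡ fromℕ m * fromℕ n
fromℕ-* m n = trans (cong fromℤ (ℤ.pos-* m n)) (fromℤ-* (+ m) (+ n))

fromℕ-mono-≤ : ∀ {m n} → m ≤ n → fromℕ m ℚ.≤ fromℕ n
fromℕ-mono-≤ m≤n = fromℤ-mono-≤ (ℤ.+≤+ m≤n)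

nonNeg-+ : ∀ {p q} → 0ℚ ℚ.≤ p → 0ℚ ℚ.≤ q → 0ℚ ℚ.≤ p + q
nonNeg-+ = ℚ.+-mono-≤

nonNeg-* : ∀ {p q} → 0ℚ ℚ.≤ p → 0ℚ ℚ.≤ q → 0ℚ ℚ.≤ p * q
nonNeg-* {p} {q} 0≤p 0≤q =
  ℚ.nonNegative⁻¹ (p * q) {{ℚ.nonNeg*nonNeg⇒nonNeg p {{ℚ.nonNegative 0≤p}} q {{ℚ.nonNegative 0≤q}}}}

nonNeg-square : ∀ p → 0ℚ ℚ.≤ p * p
nonNeg-square p with ℚ.≤-total 0ℚ p
... | inj₁ 0≤p = nonNeg-* 0≤p 0≤p
... | inj₂ p≤0 =
  ℚ.nonNegative⁻¹ (p * p) {{ℚ.nonPos*nonPos⇒nonPos p {{ℚ.nonPositive p≤0}} p {{ℚ.nonPositive p≤0}}}}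

nonNeg-/ : ∀ n d .{{_ : ℕ.NonZero d}} → 0ℚ ℚ.≤ + n / d
nonNeg-/ n d = ℚ.nonNegative⁻¹ (+ n / d) {{ℚ.normalize-nonNeg n d}}

nonNeg-cancelˡ : ∀ r {p} .{{_ : ℚ.Positive r}} → 0ℚ ℚ.≤ r * p → 0ℚ ℚ.≤ p
nonNeg-cancelˡ r {p} 0≤rp = ℚ.*-cancelˡ-≤-pos r (subst (ℚ._≤ r * p) (sym (ℚ.*-zeroʳ r)) 0≤rp)

p≤q⇒0≤q-p : ∀ {p q} → p ℚ.≤ q → 0ℚ ℚ.≤ q - p
p≤q⇒0≤q-p {p} {q} p≤q = subst (ℚ._≤ q - p) (ℚ.+-inverseʳ p) (ℚ.+-monoˡ-≤ (- p) p≤q)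

0≤q-p⇒p≤q : ∀ {p q} → 0ℚ ℚ.≤ q - p → p ℚ.≤ q
0≤q-p⇒p≤q {p} {q} 0≤q-p = subst₂ ℚ._≤_ (ℚ.+-identityʳ p) (p+[q-p]≡q p q) (ℚ.+-monoʳ-≤ p 0≤q-p)
  where
  p+[q-p]≡q : ∀ p q → p + (q - p) ≡ q
  p+[q-p]≡q = solve 2 (λ p q → p :+ (q :+ :- p) := q) refl

sumSubsets-cong : ∀ {k} {f h : Subset k → ℚ} → (∀ S → f S ≡ h S) → sumSubsets f ≡ sumSubsets h
sumSubsets-cong {zero}  f≗h = f≗h []
sumSubsets-cong {suc k} f≗h =
  cong₂ _+_ (sumSubsets-cong (f≗h ∘ (outside ∷_))) (sumSubsets-cong (f≗h ∘ (inside ∷_)))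

sumSubsets-*ˡ : ∀ {k} c (f : Subset k → ℚ) → sumSubsets (λ S → c * f S) ≡ c * sumSubsets f
sumSubsets-*ˡ {zero}  c f = refl
sumSubsets-*ˡ {suc k} c f = trans
  (cong₂ _+_ (sumSubsets-*ˡ c (f ∘ (outside ∷_))) (sumSubsets-*ˡ c (f ∘ (inside ∷_))))
  (sym (ℚ.*-distribˡ-+ c _ _))

symmetric : ∀ {k} → (ℕ → ℚ) → MultilinPoly k
symmetric q S = q ∣ S ∣

eval-symmetric-∷ : ∀ {k} (q : ℕ → ℚ) x (z : Cube k) →
  eval (symmetric q) (x ∷ z) ≡ eval (symmetric q) z + sgnℚ x * eval (symmetric (q ∘ suc)) z
eval-symmetric-∷ q x z = cong (λ r → eval (symmetric q) z + r) (begin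
  sumSubsets (λ S → q (suc ∣ S ∣) * (sgnℚ x * monomial S z))
    ≡⟨ sumSubsets-cong (λ S → x∙yz≈y∙xz (q (suc ∣ S ∣)) (sgnℚ x) (monomial S z)) ⟩
  sumSubsets (λ S → sgnℚ x * (q (suc ∣ S ∣) * monomial S z))
    ≡⟨ sumSubsets-*ˡ (sgnℚ x) (λ S → q (suc ∣ S ∣) * monomial S z) ⟩
  sgnℚ x * eval (symmetric (q ∘ suc)) z ∎)
  where open ≡-Reasoning

coordSumℚ : ∀ {k} → Cube k → ℚ
coordSumℚ z = fromℤ (coordSum z)

coordSumℚ-∷ : ∀ {k} x (z : Cube k) → coordSumℚ (x ∷ z) ≡ sgnℚ x + coordSumℚ z
coordSumℚ-∷ x z = trans (fromℤ-+ (sgnℤ x) (coordSum z)) (cong (_+ coordSumℚ z) (fromℤ-sgnℤ x))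
  where
  fromℤ-sgnℤ : ∀ x → fromℤ (sgnℤ x) ≡ sgnℚ x
  fromℤ-sgnℤ Sign.+ = refl
  fromℤ-sgnℤ Sign.- = refl

-- Polynomial expressions are written once and interpreted both in ℚ and as ring-solver syntax.

record RawℚAlgebra (A : Set) : Set where
  infixl 6 _⊕_ _⊖_
  infixl 7 _⊗_
  field
    _⊕_ _⊗_ : A → A → A
    ⊝_      : A → A
    ⟨_⟩     : ℚ → A

  _⊖_ : A → A → A
  x ⊖ y = x ⊕ ⊝ y

  # : ℕ → A
  # n = ⟨ + n / 1 ⟩

ℚ-algebra : RawℚAlgebra ℚ
ℚ-algebra = record { _⊕_ = _+_ ; _⊗_ = _*_ ; ⊝_ = -_ ; ⟨_⟩ = λ q → q }

syntax-algebra : ∀ {n} → RawℚAlgebra (Polynomial n)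
syntax-algebra = record { _⊕_ = _:+_ ; _⊗_ = _:*_ ; ⊝_ = :-_ ; ⟨_⟩ = con }

module Expressions {A : Set} (𝒜 : RawℚAlgebra A) where
  open RawℚAlgebra 𝒜

  -- eⱼ K s is the j-th elementary symmetric polynomial at any point of {-1,1}^K with coordinate sum s.
  e₂ e₃ e₄ : A → A → A
  e₂ K s = ⟨ + 1 / 2 ⟩ ⊗ (s ⊗ s ⊖ K)
  e₃ K s = ⟨ + 1 / 6 ⟩ ⊗ (s ⊗ s ⊗ s ⊖ (# 3 ⊗ K ⊖ # 2) ⊗ s)
  e₄ K s = ⟨ + 1 / 24 ⟩ ⊗ (s ⊗ s ⊗ s ⊗ s ⊖ (# 6 ⊗ K ⊖ # 8) ⊗ s ⊗ s ⊕ # 3 ⊗ K ⊗ K ⊖ # 6 ⊗ K)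

  expansion : A → A → A → A → A → A → A → A
  expansion K a₀ a₁ a₂ a₃ a₄ s =
    a₀ ⊕ a₁ ⊗ s ⊕ a₂ ⊗ e₂ K s ⊕ a₃ ⊗ e₃ K s ⊕ a₄ ⊗ e₄ K s

  g : A → A
  g v = # 1 ⊕ ⟨ + 1 / 40 ⟩ ⊗ v ⊗ ((v ⊖ # 2) ⊗ (v ⊖ # 2)) ⊗ (# 2 ⊗ v ⊕ # 5)

  g-sumOfSquares : A → A
  g-sumOfSquares v = (# 4 ⊗ v ⊗ v ⊖ # 3 ⊗ v ⊖ # 16) ⊗ (# 4 ⊗ v ⊗ v ⊖ # 3 ⊗ v ⊖ # 16)
                     ⊕ # 16 ⊗ ((v ⊕ # 2) ⊗ (v ⊕ # 2)) ⊕ # 7 ⊗ (v ⊗ v)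

  -- g v = 1 + v/2 - 3v²/10 - 3v³/40 + v⁴/20, and on {-1,1}^K the powers of s = Σ zᵢ are
  -- s² = K + 2e₂, s³ = 6e₃ + (3K-2)s, s⁴ = 24e₄ + (12K-16)e₂ + 3K² - 2K.
  constantTerm coefficient₁ coefficient₂ : A → A → A
  constantTerm t K = # 1 ⊖ ⟨ + 3 / 10 ⟩ ⊗ t ⊗ t ⊗ K
                     ⊕ ⟨ + 1 / 20 ⟩ ⊗ t ⊗ t ⊗ t ⊗ t ⊗ (# 3 ⊗ K ⊗ K ⊖ # 2 ⊗ K)
  coefficient₁ t K = ⟨ + 1 / 2 ⟩ ⊗ t ⊖ ⟨ + 3 / 40 ⟩ ⊗ (# 3 ⊗ K ⊖ # 2) ⊗ t ⊗ t ⊗ t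
  coefficient₂ t K = ⊝ ⟨ + 3 / 5 ⟩ ⊗ t ⊗ t ⊕ ⟨ + 1 / 20 ⟩ ⊗ (# 12 ⊗ K ⊖ # 16) ⊗ t ⊗ t ⊗ t ⊗ t

  coefficient₃ coefficient₄ : A → A
  coefficient₃ t = ⊝ ⟨ + 9 / 20 ⟩ ⊗ t ⊗ t ⊗ t
  coefficient₄ t = ⟨ + 6 / 5 ⟩ ⊗ t ⊗ t ⊗ t ⊗ t

  scaledSlack : A → A → A → A
  scaledSlack c K L = ⊝ # 2 ⊗ L ⊗ L ⊗ L ⊗ L ⊕ # 6 ⊗ c ⊗ c ⊗ K ⊗ L ⊗ L
                      ⊖ c ⊗ c ⊗ c ⊗ c ⊗ (# 3 ⊗ K ⊗ K ⊖ # 2 ⊗ K)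

  slackCertificate : A → A → A → A
  slackCertificate u w L = # 3 ⊗ w ⊗ w ⊕ # 6 ⊗ u ⊗ w ⊕ # 2 ⊗ u ⊕ L ⊗ L ⊗ (L ⊗ L ⊖ # 10)

open Expressions ℚ-algebra
module Syntax {n} = Expressions (syntax-algebra {n})

expansion-[] : ∀ a₀ a₁ a₂ a₃ a₄ → a₀ * 1ℚ ≡ expansion 0ℚ a₀ a₁ a₂ a₃ a₄ 0ℚ
expansion-[] = solve 5 (λ a₀ a₁ a₂ a₃ a₄ →
  a₀ :* con 1ℚ := Syntax.expansion (con 0ℚ) a₀ a₁ a₂ a₃ a₄ (con 0ℚ)) refl

-- The recurrence eⱼ(x ∷ z) = eⱼ(z) + x eⱼ₋₁(z), checked on the closed forms.
expansion-∷ : ∀ x K a₀ a₁ a₂ a₃ a₄ s →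
  expansion (1ℚ + K) a₀ a₁ a₂ a₃ a₄ (sgnℚ x + s)
    ≡ expansion K a₀ a₁ a₂ a₃ a₄ s + sgnℚ x * expansion K a₁ a₂ a₃ a₄ 0ℚ s
expansion-∷ Sign.+ = solve 7 (λ K a₀ a₁ a₂ a₃ a₄ s →
  Syntax.expansion (con 1ℚ :+ K) a₀ a₁ a₂ a₃ a₄ (con 1ℚ :+ s)
    := Syntax.expansion K a₀ a₁ a₂ a₃ a₄ s
         :+ con 1ℚ :* Syntax.expansion K a₁ a₂ a₃ a₄ (con 0ℚ) s) refl
expansion-∷ Sign.- = solve 7 (λ K a₀ a₁ a₂ a₃ a₄ s →
  Syntax.expansion (con 1ℚ :+ K) a₀ a₁ a₂ a₃ a₄ (con (- 1ℚ) :+ s)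
    := Syntax.expansion K a₀ a₁ a₂ a₃ a₄ s
         :+ con (- 1ℚ) :* Syntax.expansion K a₁ a₂ a₃ a₄ (con 0ℚ) s) refl

eval-symmetric≡expansion : ∀ {k} (q : ℕ → ℚ) → (∀ j → q (5 ℕ.+ j) ≡ 0ℚ) → (z : Cube k) →
  eval (symmetric q) z ≡ expansion (fromℕ k) (q 0) (q 1) (q 2) (q 3) (q 4) (coordSumℚ z)
eval-symmetric≡expansion q q-vanishes [] = expansion-[] (q 0) (q 1) (q 2) (q 3) (q 4)
eval-symmetric≡expansion {suc k} q q-vanishes (x ∷ z) = begin
  eval (symmetric q) (x ∷ z)
    ≡⟨ eval-symmetric-∷ q x z ⟩
  eval (symmetric q) z + sgnℚ x * eval (symmetric (q ∘ suc)) z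
    ≡⟨ cong₂ (λ a b → a + sgnℚ x * b) (eval-symmetric≡expansion q q-vanishes z)
             (eval-symmetric≡expansion (q ∘ suc) (q-vanishes ∘ suc) z) ⟩
  E (q 0) (q 1) (q 2) (q 3) (q 4) + sgnℚ x * E (q 1) (q 2) (q 3) (q 4) (q 5)
    ≡⟨ cong (λ a → E (q 0) (q 1) (q 2) (q 3) (q 4) + sgnℚ x * E (q 1) (q 2) (q 3) (q 4) a) (q-vanishes 0) ⟩
  E (q 0) (q 1) (q 2) (q 3) (q 4) + sgnℚ x * E (q 1) (q 2) (q 3) (q 4) 0ℚ
    ≡⟨ expansion-∷ x K (q 0) (q 1) (q 2) (q 3) (q 4) s ⟨
  expansion (1ℚ + K) (q 0) (q 1) (q 2) (q 3) (q 4) (sgnℚ x + s)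
    ≡⟨ cong₂ (λ K′ s′ → expansion K′ (q 0) (q 1) (q 2) (q 3) (q 4) s′)
             (fromℕ-suc k) (coordSumℚ-∷ x z) ⟨
  expansion (fromℕ (suc k)) (q 0) (q 1) (q 2) (q 3) (q 4) (coordSumℚ (x ∷ z)) ∎
  where
  open ≡-Reasoning
  K = fromℕ k
  s = coordSumℚ z
  E : ℚ → ℚ → ℚ → ℚ → ℚ → ℚ
  E a₀ a₁ a₂ a₃ a₄ = expansion K a₀ a₁ a₂ a₃ a₄ s

expansion≡g-constantTerm : ∀ t K s →
  expansion K 0ℚ (coefficient₁ t K) (coefficient₂ t K) (coefficient₃ t) (coefficient₄ t) s
    ≡ g (t * s) - constantTerm t K
expansion≡g-constantTerm = solve 3 (λ t K s →
  Syntax.expansion K (con 0ℚ) (Syntax.coefficient₁ t K) (Syntax.coefficient₂ t K)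
                   (Syntax.coefficient₃ t) (Syntax.coefficient₄ t) s
    := Syntax.g (t :* s) :+ :- Syntax.constantTerm t K) refl

g≡sumOfSquares : ∀ v → + 320 / 1 * g v ≡ g-sumOfSquares v
g≡sumOfSquares = solve 1 (λ v → con (+ 320 / 1) :* Syntax.g v := Syntax.g-sumOfSquares v) refl

g-nonNeg : ∀ v → 0ℚ ℚ.≤ g v
g-nonNeg v = nonNeg-cancelˡ (+ 320 / 1) (subst (0ℚ ℚ.≤_) (sym (g≡sumOfSquares v))
  (nonNeg-+ (nonNeg-+ (nonNeg-square (+ 4 / 1 * v * v - + 3 / 1 * v - + 16 / 1))
                      (nonNeg-* (nonNeg-/ 16 1) (nonNeg-square (v + + 2 / 1))))
            (nonNeg-* (nonNeg-/ 7 1) (nonNeg-square v))))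

1≤g : ∀ {v} → 0ℚ ℚ.≤ v → 1ℚ ℚ.≤ g v
1≤g {v} 0≤v = ℚ.+-monoʳ-≤ 1ℚ
  (nonNeg-* (nonNeg-* (nonNeg-* (nonNeg-/ 1 40) 0≤v) (nonNeg-square (v - + 2 / 1)))
            (nonNeg-+ (nonNeg-* (nonNeg-/ 2 1) 0≤v) (nonNeg-/ 5 1)))

constantTerm-slack : ∀ t K L →
  + 20 / 1 * (L * L * (L * L)) * (+ 9 / 10 - constantTerm t K) ≡ scaledSlack (t * L) K L
constantTerm-slack = solve 3 (λ t K L →
  con (+ 20 / 1) :* (L :* L :* (L :* L)) :* (con (+ 9 / 10) :+ :- Syntax.constantTerm t K)
    := Syntax.scaledSlack (t :* L) K L) refl

scaledSlack≡certificate : ∀ K L →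
  scaledSlack 1ℚ K L ≡ slackCertificate (K - L * L) ((1ℚ + L) * (1ℚ + L) - (1ℚ + K)) L
scaledSlack≡certificate = solve 2 (λ K L →
  Syntax.scaledSlack (con 1ℚ) K L
    := Syntax.slackCertificate (K :+ :- (L :* L)) ((con 1ℚ :+ L) :* (con 1ℚ :+ L) :+ :- (con 1ℚ :+ K)) L) refl

slackCertificate-nonNeg : ∀ {u w L} → 0ℚ ℚ.≤ u → 0ℚ ℚ.≤ w → + 10 / 1 ℚ.≤ L * L →
  0ℚ ℚ.≤ slackCertificate u w L
slackCertificate-nonNeg {u} {w} {L} 0≤u 0≤w 10≤L² =
  nonNeg-+ (nonNeg-+ (nonNeg-+ (nonNeg-* (nonNeg-* (nonNeg-/ 3 1) 0≤w) 0≤w)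
                               (nonNeg-* (nonNeg-* (nonNeg-/ 6 1) 0≤u) 0≤w))
                     (nonNeg-* (nonNeg-/ 2 1) 0≤u))
           (nonNeg-* (nonNeg-square L) (p≤q⇒0≤q-p 10≤L²))

constantTerm≤9/10 : ∀ t K L → t * L ≡ 1ℚ →
  L * L ℚ.≤ K → 1ℚ + K ℚ.≤ (1ℚ + L) * (1ℚ + L) → + 10 / 1 ℚ.≤ L * L →
  constantTerm t K ℚ.≤ + 9 / 10
constantTerm≤9/10 t K L tL≡1 L²≤K 1+K≤[1+L]² 10≤L² =
  0≤q-p⇒p≤q (nonNeg-cancelˡ (+ 20 / 1 * L⁴) {{20L⁴-pos}} (subst (0ℚ ℚ.≤_) (sym slack≡certificate)
    (slackCertificate-nonNeg {L = L} (p≤q⇒0≤q-p L²≤K) (p≤q⇒0≤q-p 1+K≤[1+L]²) 10≤L²)))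
  where
  L⁴ = L * L * (L * L)
  slack≡certificate : + 20 / 1 * L⁴ * (+ 9 / 10 - constantTerm t K)
                        ≡ slackCertificate (K - L * L) ((1ℚ + L) * (1ℚ + L) - (1ℚ + K)) L
  slack≡certificate = begin
    + 20 / 1 * L⁴ * (+ 9 / 10 - constantTerm t K)  ≡⟨ constantTerm-slack t K L ⟩
    scaledSlack (t * L) K L                        ≡⟨ cong (λ c → scaledSlack c K L) tL≡1 ⟩
    scaledSlack 1ℚ K L                             ≡⟨ scaledSlack≡certificate K L ⟩
    slackCertificate (K - L * L) ((1ℚ + L) * (1ℚ + L) - (1ℚ + K)) L ∎
    where open ≡-Reasoning
  L²-pos : ℚ.Positive (L * L)
  L²-pos = ℚ.positive (ℚ.<-≤-trans (ℚ.positive⁻¹ (+ 10 / 1)) 10≤L²)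
  20L⁴-pos : ℚ.Positive (+ 20 / 1 * L⁴)
  20L⁴-pos = ℚ.pos*pos⇒pos (+ 20 / 1) L⁴ {{ℚ.pos*pos⇒pos (L * L) {{L²-pos}} (L * L) {{L²-pos}}}}

separator : ℚ → ℚ → ℕ → ℚ
separator t K 1 = coefficient₁ t K
separator t K 2 = coefficient₂ t K
separator t K 3 = coefficient₃ t
separator t K 4 = coefficient₄ t
separator t K _ = 0ℚ

separator-degree : ∀ {k} t K → DegreeAtMost 4 (symmetric {k} (separator t K))
separator-degree t K S = vanishes
  where
  vanishes : ∀ {j} → 4 < j → separator t K j ≡ 0ℚ
  vanishes (s≤s (s≤s (s≤s (s≤s (s≤s _))))) = refl

eval-separator : ∀ {k} t (z : Cube k) →
  eval (symmetric (separator t (fromℕ k))) z ≡ g (t * coordSumℚ z) - constantTerm t (fromℕ k)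
eval-separator {k} t z = trans (eval-symmetric≡expansion (separator t (fromℕ k)) (λ _ → refl) z)
                               (expansion≡g-constantTerm t (fromℕ k) (coordSumℚ z))

separator-separates : ∀ {k} t → 0ℚ ℚ.≤ t → constantTerm t (fromℕ k) ℚ.≤ + 9 / 10 →
  Separates (+ 1 / 10) Thr1 (symmetric {k} (separator t (fromℕ k)))
separator-separates {k} t 0≤t c≤9/10 = record
  { lowerAll = λ z → margin z (g-nonNeg (t * coordSumℚ z))
  ; lowerSat = λ z thr → margin z (1≤g (nonNeg-* 0≤t (coordSumℚ-nonNeg z thr)))
  ; noConst  = cong (separator t (fromℕ k)) (∣⊥∣≡0 k)
  }
  where
  margin : ∀ {b} (z : Cube k) → b ℚ.≤ g (t * coordSumℚ z) →
    b - + 9 / 10 ℚ.≤ eval (symmetric (separator t (fromℕ k))) z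
  margin z b≤g = subst (ℚ._≤_ _) (sym (eval-separator t z)) (ℚ.+-mono-≤ b≤g (ℚ.neg-antimono-≤ c≤9/10))
  coordSumℚ-nonNeg : ∀ (z : Cube k) → Thr1 z → 0ℚ ℚ.≤ coordSumℚ z
  coordSumℚ-nonNeg z thr = fromℤ-mono-≤ (ℤ.≤-trans (ℤ.+≤+ z≤n) thr)

integerSqrt : ∀ n → ∃ λ m → m ℕ.* m ≤ n × n < suc m ℕ.* suc m
integerSqrt zero = 0 , z≤n , s≤s z≤n
integerSqrt (suc n) with integerSqrt n
... | m , m²≤n , n<[m+1]² with suc n ℕ.<? suc m ℕ.* suc m
...   | yes n+1<[m+1]² = m , ℕ.m≤n⇒m≤1+n m²≤n , n+1<[m+1]²
...   | no  n+1≮[m+1]² = suc m , ℕ.≮⇒≥ n+1≮[m+1]² ,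
        ℕ.≤-<-trans n<[m+1]² (ℕ.*-mono-< (ℕ.n<1+n (suc m)) (ℕ.n<1+n (suc m)))

≤-sqrt : ∀ {d m n} → d ℕ.* d ≤ n → n < suc m ℕ.* suc m → d ≤ m
≤-sqrt {d} {m} d²≤n n<[m+1]² with d ℕ.≤? m
... | yes d≤m = d≤m
... | no  d≰m = contradiction (ℕ.≤-trans (ℕ.*-mono-≤ m<d m<d) d²≤n) (ℕ.<⇒≱ n<[m+1]²)
  where m<d = ℕ.≰⇒> d≰m

reciprocal : ∀ n .{{_ : ℕ.NonZero n}} → ∃ λ t → 0ℚ ℚ.≤ t × t * fromℕ n ≡ 1ℚ
reciprocal (suc n) = 1/ fromℕ (suc n) , ℚ.nonNegative⁻¹ (1/ fromℕ (suc n)) , ℚ.*-inverseˡ (fromℕ (suc n))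

constantTerm-sqrt≤9/10 : ∀ {k m} t → t * fromℕ m ≡ 1ℚ →
  m ℕ.* m ≤ k → k < suc m ℕ.* suc m → 10 ≤ m ℕ.* m → constantTerm t (fromℕ k) ℚ.≤ + 9 / 10
constantTerm-sqrt≤9/10 {k} {m} t tm≡1 m²≤k k<[m+1]² 10≤m² =
  constantTerm≤9/10 t (fromℕ k) (fromℕ m) tm≡1
  (subst (ℚ._≤ fromℕ k) (fromℕ-* m m) (fromℕ-mono-≤ m²≤k))
  (subst₂ ℚ._≤_ (fromℕ-suc k) [1+m]² (fromℕ-mono-≤ k<[m+1]²))
  (subst (ℚ._≤_ (+ 10 / 1)) (fromℕ-* m m) (fromℕ-mono-≤ 10≤m²))
  where
  [1+m]² : fromℕ (suc m ℕ.* suc m) ≡ (1ℚ + fromℕ m) * (1ℚ + fromℕ m)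
  [1+m]² = trans (fromℕ-* (suc m) (suc m)) (cong₂ _*_ (fromℕ-suc m) (fromℕ-suc m))

theorem5p13 : ∀ (k : ℕ) → Odd k → 25 ≤ k →
    ∃ λ (Q : MultilinPoly k) → DegreeAtMost 4 Q × Separates (+ 1 / 10) Thr1 Q
theorem5p13 k _ 25≤k =
  let m , m²≤k , k<[m+1]² = integerSqrt k
      5≤m : 5 ≤ m
      5≤m = ≤-sqrt {5} {m} 25≤k k<[m+1]²
      t , 0≤t , tm≡1 = reciprocal m {{ℕ.>-nonZero (ℕ.≤-trans (s≤s z≤n) 5≤m)}}
      10≤m² = ℕ.≤-trans (ℕ.m≤m+n 10 15) (ℕ.*-mono-≤ 5≤m 5≤m)
  in symmetric (separator t (fromℕ k)) , separator-degree t (fromℕ k) ,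
     separator-separates t 0≤t (constantTerm-sqrt≤9/10 t tm≡1 m²≤k k<[m+1]² 10≤m²)
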